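{- Let $E$ be a set and $f:F\to E$ a super-sequence, $F$ a front on $X$. Then $f$ is spare if and only if whenever $t\in F$ and $s\sqsubset t$, there exists $t'\in F$ with $s\sqsubset t'$ and $f(t)\neq f(t')$.
   Context: For $u,v\subseteq\omega$, $u\sqsubseteq v$ means $u=v$ or $u=\{k\in v\mid k<n\}$ for some $n\in v$; $u\sqsubset v$ means $u\sqsubseteq v$, $u\neq v$. A front on an infinite $X\subseteq\omega$ is a family $F$ of finite subsets of $\omega$ with (i) $F=\{\emptyset\}$ or $\bigcup F=X$; (ii) $s,t\in F$, $s\sqsubseteq t\Rightarrow s=t$; (iii) every infinite $X'\subseteq X$ has some $s\in F$ with $s\sqsubset X'$. A super-sequence is a map from a front. Define $f^{\uparrow}$ on infinite $Y\subseteq X$ by $f^{\uparrow}(Y)=f(s)$ for the unique $s\in F$ with $s\sqsubset Y$, and for finite $s\subseteq X$ let $M_{s}=\{Y\subseteq X \text{ infinite}\mid s\sqsubset Y\}$. $f$ is spare if $F$ equals the set of $\sqsubseteq$-minimal finite $s\subseteq X$ such that $f^{\uparrow}$ is constant on $M_{s}$. -}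

module Defs where

open import Data.Nat using (ℕ; _≤_; _<_)
open import Data.List using (List; [])
open import Data.List.Membership.Propositional using (_∈_)
open import Data.List.Relation.Unary.Linked using (Linked)
open import Data.Product using (_×_; ∃; Σ)
open import Data.Sum using (_⊎_)
open import Relation.Nullary using (¬_)
open import Relation.Binary.PropositionalEquality using (_≡_)
open import Level using (0ℓ)
open import Relation.Unary using (Pred)

-- Subsets of ω are predicates on ℕ.  A finite subset of ω is represented
-- canonically by the strictly increasing list of its elements.
Subset : Set₁
Subset = Pred ℕ 0ℓ

⟦_⟧ : List ℕ → Subset
⟦ u ⟧ k = k ∈ u

Increasing : List ℕ → Set
Increasing = Linked _<_

Infinite : Subset → Set
Infinite Y = ∀ n → ∃ λ m → n ≤ m × Y m

_⊆ₛ_ : Subset → Subset → Set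
Y ⊆ₛ X = ∀ k → Y k → X k

_≐_ : Subset → Subset → Set
U ≐ V = ∀ k → (U k → V k) × (V k → U k)

_⊑_ : List ℕ → Subset → Set
u ⊑ V = (⟦ u ⟧ ≐ V)
      ⊎ (∃ λ n → V n × (∀ k → (k ∈ u → V k × k < n) × (V k × k < n → k ∈ u)))

_⊏_ : List ℕ → Subset → Set
u ⊏ V = (u ⊑ V) × ¬ (⟦ u ⟧ ≐ V)

record Front (X : Subset) (F : List ℕ → Set) : Set₁ where
  field
    finite-sets : ∀ s → F s → Increasing s
    cond-i      : (∀ s → (F s → s ≡ []) × (s ≡ [] → F s))
                ⊎ (∀ k → (X k → ∃ λ s → F s × k ∈ s) × (∃ (λ s → F s × k ∈ s) → X k))
    cond-ii     : ∀ s t → F s → F t → s ⊑ ⟦ t ⟧ → s ≡ t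
    cond-iii    : ∀ (X' : Subset) → X' ⊆ₛ X → Infinite X' → ∃ λ s → F s × s ⊏ X'

M : Subset → List ℕ → Subset → Set
M X s Y = (Y ⊆ₛ X) × Infinite Y × (s ⊏ Y)

-- f↑ is constant on M_s, where f↑(Y) = f(t) for the (unique) t ∈ F with t ⊏ Y.
ConstOn : {E : Set} (X : Subset) (F : List ℕ → Set) (f : List ℕ → E) → List ℕ → Set₁
ConstOn X F f s = ∀ (Y Y' : Subset) → M X s Y → M X s Y' →
                  ∀ t t' → F t → F t' → t ⊏ Y → t' ⊏ Y' → f t ≡ f t'

Minimal : {E : Set} (X : Subset) (F : List ℕ → Set) (f : List ℕ → E) → List ℕ → Set₁
Minimal X F f s = Increasing s × (⟦ s ⟧ ⊆ₛ X) × ConstOn X F f s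
                × (∀ u → Increasing u → ⟦ u ⟧ ⊆ₛ X → u ⊏ ⟦ s ⟧ → ¬ ConstOn X F f u)

Spare : {E : Set} (X : Subset) (F : List ℕ → Set) (f : List ℕ → E) → Set₁
Spare X F f = ∀ s → (F s → Minimal X F f s) × (Minimal X F f s → F s)

-- Condition (iii) of a front is strong enough to decide any proposition P:
-- fix a ∈ X and apply it to {a | P} ∪ {k ∈ X | a < k}; whether a lies in the
-- resulting initial segment decides P.  With excluded middle available, both
-- directions are direct: if some proper initial segment s of t ∈ F admitted no
-- t' ∈ F above it with a different value, f↑ would be constant on M_s,
-- contradicting minimality of t; conversely, any two members of F above a
-- common s give two sets in M_s on which f↑ takes their two values.
module Submission where

open import Defs
open import Data.Nat using (ℕ)
open import Data.List using (List)
open import Data.Product using (_×_; ∃)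
open import Function.Bundles using (_⇔_)
open import Relation.Binary.PropositionalEquality using (_≢_)

open import Axiom.ExcludedMiddle using (ExcludedMiddle)
open import Data.Empty using (⊥-elim)
open import Data.List using ([]; _∷_)
open import Data.List.Extrema.Nat using (max; xs≤max)
open import Data.List.Membership.Propositional using (_∈_)
open import Data.List.Relation.Unary.All using (lookup)
open import Data.List.Relation.Unary.Any using (here; there)
open import Data.List.Relation.Unary.Linked using ([]; [-]; _∷_)
open import Data.Nat using (suc; _+_; _≤_; _<_; s≤s)
open import Data.Nat.Properties
  using (_≟_; <-cmp; <-irrefl; <-asym; <-trans; <-≤-trans; ≤-trans; <⇒≤; m≤m+n; m≤n+m; ≤-refl)
open import Data.List.Membership.DecPropositional _≟_ using (_∈?_)
open import Data.Product using (_,_; proj₁; proj₂; Σ)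
open import Data.Sum using (_⊎_; inj₁; inj₂)
open import Function.Bundles using (mk⇔)
open import Level using (0ℓ)
open import Relation.Binary using (tri<; tri≈; tri>)
open import Relation.Binary.PropositionalEquality using (_≡_; refl; sym; trans; cong; subst)
open import Relation.Nullary using (¬_; Dec; yes; no)

InitialSegment : List ℕ → Subset → ℕ → Set
InitialSegment u Y n = Y n × (∀ k → (k ∈ u → Y k × k < n) × (Y k × k < n → k ∈ u))

segment⇒⊏ : ∀ {u Y n} → InitialSegment u Y n → u ⊏ Y
segment⇒⊏ {n = n} seg@(Yn , below) =
  inj₂ (n , seg) , λ u≐Y → <-irrefl refl (proj₂ (proj₁ (below n) (proj₂ (u≐Y n) Yn)))

⊏⇒segment : ∀ {u Y} → u ⊏ Y → ∃ (InitialSegment u Y)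
⊏⇒segment (inj₁ u≐Y , u≭Y) = ⊥-elim (u≭Y u≐Y)
⊏⇒segment (inj₂ seg , _)   = seg

⊑⇒⊆ : ∀ {u s} → u ⊑ ⟦ s ⟧ → ⟦ u ⟧ ⊆ₛ ⟦ s ⟧
⊑⇒⊆ (inj₁ u≐s)              k k∈u = proj₁ (u≐s k) k∈u
⊑⇒⊆ (inj₂ (_ , _ , below)) k k∈u = proj₁ (proj₁ (below k) k∈u)

segment-trans : ∀ {u s Y m n} →
  InitialSegment u ⟦ s ⟧ m → InitialSegment s Y n → InitialSegment u Y m
segment-trans {m = m} (m∈s , g) (_ , h) =
    proj₁ (proj₁ (h m) m∈s)
  , λ k → (λ k∈u → let k∈s , k<m = proj₁ (g k) k∈u in proj₁ (proj₁ (h k) k∈s) , k<m)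
        , λ (Yk , k<m) → proj₂ (g k) (proj₂ (h k) (Yk , <-trans k<m m<n) , k<m)
  where m<n = proj₂ (proj₁ (h m) m∈s)

segment-≐ : ∀ {u s Y n} → ⟦ u ⟧ ≐ ⟦ s ⟧ → InitialSegment s Y n → InitialSegment u Y n
segment-≐ u≐s (Yn , h) =
  Yn , λ k → (λ k∈u → proj₁ (h k) (proj₁ (u≐s k) k∈u)) , λ p → proj₂ (u≐s k) (proj₂ (h k) p)

segment-of-segment : ∀ {s t Y m n} →
  InitialSegment s Y n → InitialSegment t Y m → m < n → InitialSegment t ⟦ s ⟧ m
segment-of-segment {m = m} (_ , h) (Ym , g) m<n =
    proj₂ (h m) (Ym , m<n)
  , λ k → (λ k∈t → let Yk , k<m = proj₁ (g k) k∈t in proj₂ (h k) (Yk , <-trans k<m m<n) , k<m)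
        , λ (k∈s , k<m) → proj₂ (g k) (proj₁ (proj₁ (h k) k∈s) , k<m)

⊑-⊏-trans : ∀ {u s Y} → u ⊑ ⟦ s ⟧ → s ⊏ Y → u ⊏ Y
⊑-⊏-trans u⊑s s⊏Y with ⊏⇒segment s⊏Y | u⊑s
... | _ , s-seg | inj₁ u≐s        = segment⇒⊏ (segment-≐ u≐s s-seg)
... | _ , s-seg | inj₂ (_ , u-seg) = segment⇒⊏ (segment-trans u-seg s-seg)

⊏-comparable : ∀ {s t Y} → s ⊏ Y → t ⊏ Y → t ⊑ ⟦ s ⟧ ⊎ s ⊏ ⟦ t ⟧
⊏-comparable s⊏Y t⊏Y with ⊏⇒segment s⊏Y | ⊏⇒segment t⊏Y
... | n , s-seg@(_ , h) | m , t-seg@(_ , g) with <-cmp m n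
...   | tri< m<n _ _  = inj₁ (inj₂ (m , segment-of-segment s-seg t-seg m<n))
...   | tri> _ _ n<m  = inj₂ (segment⇒⊏ (segment-of-segment t-seg s-seg n<m))
...   | tri≈ _ refl _ =
  inj₁ (inj₁ λ k → (λ k∈t → proj₂ (h k) (proj₁ (g k) k∈t)) , λ k∈s → proj₂ (g k) (proj₁ (h k) k∈s))

∈-tail : ∀ {x k xs} → k ∈ x ∷ xs → x < k → k ∈ xs
∈-tail (here refl) x<x = ⊥-elim (<-irrefl refl x<x)
∈-tail (there k∈xs) _  = k∈xs

head<tail : ∀ {x k xs} → Increasing (x ∷ xs) → k ∈ xs → x < k
head<tail (x<y ∷ _)  (here refl) = x<y
head<tail (x<y ∷ xs↗) (there k∈xs) = <-trans x<y (head<tail xs↗ k∈xs)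

tail-Increasing : ∀ {x xs} → Increasing (x ∷ xs) → Increasing xs
tail-Increasing [-]       = []
tail-Increasing (_ ∷ xs↗) = xs↗

Increasing-≐⇒≡ : ∀ {s t} → Increasing s → Increasing t → ⟦ s ⟧ ≐ ⟦ t ⟧ → s ≡ t
Increasing-≐⇒≡ {[]}     {[]}     _ _ _ = refl
Increasing-≐⇒≡ {[]}     {y ∷ _}  _ _ s≐t with () ← proj₂ (s≐t y) (here refl)
Increasing-≐⇒≡ {x ∷ _}  {[]}     _ _ s≐t with () ← proj₁ (s≐t x) (here refl)
Increasing-≐⇒≡ {x ∷ xs} {y ∷ ys} s↗ t↗ s≐t with heads-≡
  where
  heads-≡ : x ≡ y
  heads-≡ with proj₁ (s≐t x) (here refl) | proj₂ (s≐t y) (here refl)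
  ... | here x≡y   | _          = x≡y
  ... | there _    | here y≡x   = sym y≡x
  ... | there x∈ys | there y∈xs = ⊥-elim (<-asym (head<tail t↗ x∈ys) (head<tail s↗ y∈xs))
... | refl = cong (x ∷_) (Increasing-≐⇒≡ (tail-Increasing s↗) (tail-Increasing t↗) tails-≐)
  where
  tails-≐ : ⟦ xs ⟧ ≐ ⟦ ys ⟧
  tails-≐ k = (λ k∈xs → ∈-tail (proj₁ (s≐t k) (there k∈xs)) (head<tail s↗ k∈xs))
            , (λ k∈ys → ∈-tail (proj₂ (s≐t k) (there k∈ys)) (head<tail t↗ k∈ys))

M-inhabited : ∀ {X} → Infinite X → ∀ s → ⟦ s ⟧ ⊆ₛ X → Σ Subset (M X s)
M-inhabited {X} infinite s s⊆X with infinite (suc (max 0 s))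
... | n , s<n , Xn = Y , Y⊆X , Y-infinite , segment⇒⊏ (inj₂ (Xn , ≤-refl) , s-below-n)
  where
  Y : Subset
  Y k = k ∈ s ⊎ (X k × n ≤ k)

  Y⊆X : Y ⊆ₛ X
  Y⊆X k (inj₁ k∈s)     = s⊆X k k∈s
  Y⊆X k (inj₂ (Xk , _)) = Xk

  Y-infinite : Infinite Y
  Y-infinite m with infinite (m + n)
  ... | k , m+n≤k , Xk = k , ≤-trans (m≤m+n m n) m+n≤k , inj₂ (Xk , ≤-trans (m≤n+m n m) m+n≤k)

  s-below-n : ∀ k → (k ∈ s → Y k × k < n) × (Y k × k < n → k ∈ s)
  s-below-n k = (λ k∈s → inj₁ k∈s , <-≤-trans (s≤s (lookup (xs≤max 0 s) k∈s)) s<n)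
              , λ { (inj₁ k∈s , _) → k∈s
                  ; (inj₂ (_ , n≤k) , k<n) → ⊥-elim (<-irrefl refl (<-≤-trans k<n n≤k)) }

module _ {X : Subset} (infinite : Infinite X) {a : ℕ} (Xa : X a) (P : Set) where
  private
    X⁺ : Subset
    X⁺ k = X k × ((k ≡ a × P) ⊎ a < k)

    X⁺-infinite : Infinite X⁺
    X⁺-infinite m with infinite (suc (m + a))
    ... | k , m+a<k , Xk =
      k , ≤-trans (m≤m+n m a) (<⇒≤ m+a<k) , Xk , inj₂ (≤-trans (s≤s (m≤n+m a m)) m+a<k)

    decide : ∀ {s n} → InitialSegment s X⁺ n → Dec P
    decide ((_ , inj₁ (_ , p)) , _) = yes p
    decide {s} ((_ , inj₂ a<n) , below) with a ∈? s
    ... | no a∉s = no λ p → a∉s (proj₂ (below a) ((Xa , inj₁ (refl , p)) , a<n))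
    ... | yes a∈s with proj₂ (proj₁ (proj₁ (below a) a∈s))
    ...   | inj₁ (_ , p) = yes p
    ...   | inj₂ a<a     = ⊥-elim (<-irrefl refl a<a)

  front⇒Dec : ∀ {F} → Front X F → Dec P
  front⇒Dec front with Front.cond-iii front X⁺ (λ _ → proj₁) X⁺-infinite
  ... | _ , _ , s⊏X⁺ = decide (proj₂ (⊏⇒segment s⊏X⁺))

front⇒excludedMiddle : ∀ {X F} → Infinite X → Front X F → ExcludedMiddle 0ℓ
front⇒excludedMiddle infinite front {P} with infinite 0
... | _ , _ , Xa = front⇒Dec infinite Xa P front

Separates : {E : Set} → (List ℕ → Set) → (List ℕ → E) → List ℕ → List ℕ → Set
Separates F f t s = ∃ λ t' → F t' × s ⊏ ⟦ t' ⟧ × f t ≢ f t'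

Separating : {E : Set} → (List ℕ → Set) → (List ℕ → E) → Set
Separating F f = ∀ t s → F t → Increasing s → s ⊏ ⟦ t ⟧ → Separates F f t s

module _ {E : Set} {X : Subset} {F : List ℕ → Set} (f : List ℕ → E)
         (infinite : Infinite X) (front : Front X F) where

  open Front front

  excluded-middle : ExcludedMiddle 0ℓ
  excluded-middle = front⇒excludedMiddle infinite front

  member⊆X : ∀ {t} → F t → ⟦ t ⟧ ⊆ₛ X
  member⊆X {t} Ft k k∈t with cond-i
  ... | inj₂ ⋃F≐X = proj₂ (⋃F≐X k) (t , Ft , k∈t)
  ... | inj₁ F≡｛∅｝ with proj₁ (F≡｛∅｝ t) Ft
  ...   | refl with () ← k∈t

  ⊏-unique : ∀ {t t' Y} → F t → F t' → t ⊏ Y → t' ⊏ Y → t ≡ t'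
  ⊏-unique Ft Ft' t⊏Y t'⊏Y with ⊏-comparable t⊏Y t'⊏Y
  ... | inj₁ t'⊑t = sym (cond-ii _ _ Ft' Ft t'⊑t)
  ... | inj₂ t⊏t' = cond-ii _ _ Ft Ft' (proj₁ t⊏t')

  member-ConstOn : ∀ {s} → F s → ConstOn X F f s
  member-ConstOn Fs _ _ (_ , _ , s⊏Y) (_ , _ , s⊏Y') _ _ Ft Ft' t⊏Y t'⊏Y' =
    trans (cong f (⊏-unique Ft Fs t⊏Y s⊏Y)) (cong f (⊏-unique Fs Ft' s⊏Y' t'⊏Y'))

  ConstOn⇒≡ : ∀ {u t t'} → ConstOn X F f u → F t → F t' → u ⊏ ⟦ t ⟧ → u ⊏ ⟦ t' ⟧ → f t ≡ f t'
  ConstOn⇒≡ {t = t} {t'} const Ft Ft' u⊏t u⊏t'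
    with M-inhabited infinite t (member⊆X Ft) | M-inhabited infinite t' (member⊆X Ft')
  ... | Y , Y⊆X , Y-infinite , t⊏Y | Y' , Y'⊆X , Y'-infinite , t'⊏Y' =
    const Y Y' (Y⊆X , Y-infinite , ⊑-⊏-trans (proj₁ u⊏t) t⊏Y)
               (Y'⊆X , Y'-infinite , ⊑-⊏-trans (proj₁ u⊏t') t'⊏Y') t t' Ft Ft' t⊏Y t'⊏Y'

  unseparated⇒ConstOn : ∀ {s t} → F t → s ⊏ ⟦ t ⟧ → ¬ Separates F f t s → ConstOn X F f s
  unseparated⇒ConstOn {s} {t} Ft s⊏t unseparated
    _ _ (_ , _ , s⊏Y) (_ , _ , s⊏Y') t₁ t₂ Ft₁ Ft₂ t₁⊏Y t₂⊏Y' =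
    trans (value≡ Ft₁ t₁⊏Y s⊏Y) (sym (value≡ Ft₂ t₂⊏Y' s⊏Y'))
    where
    value≡ : ∀ {t₀ Y} → F t₀ → t₀ ⊏ Y → s ⊏ Y → f t₀ ≡ f t
    value≡ {t₀} Ft₀ t₀⊏Y s⊏Y with ⊏-comparable s⊏Y t₀⊏Y
    ... | inj₁ t₀⊑s = cong f (cond-ii _ _ Ft₀ Ft (proj₁ (⊑-⊏-trans t₀⊑s s⊏t)))
    ... | inj₂ s⊏t₀ with excluded-middle {f t ≡ f t₀}
    ...   | yes ft≡ft₀ = sym ft≡ft₀
    ...   | no ft≢ft₀  = ⊥-elim (unseparated (t₀ , Ft₀ , s⊏t₀ , ft≢ft₀))

  spare⇒separating : Spare X F f → Separating F f
  spare⇒separating spare t s Ft s↗ s⊏t with excluded-middle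
  ... | yes separated  = separated
  ... | no unseparated =
    ⊥-elim (not-const s s↗ (λ k k∈s → member⊆X Ft k (⊑⇒⊆ (proj₁ s⊏t) k k∈s)) s⊏t
                          (unseparated⇒ConstOn Ft s⊏t unseparated))
    where not-const = proj₂ (proj₂ (proj₂ (proj₁ (spare t) Ft)))

  separating⇒spare : Separating F f → Spare X F f
  separating⇒spare separating s = member⇒minimal , minimal⇒member
    where
    member⇒minimal : F s → Minimal X F f s
    member⇒minimal Fs = finite-sets s Fs , member⊆X Fs , member-ConstOn Fs , not-const
      where
      not-const : ∀ u → Increasing u → ⟦ u ⟧ ⊆ₛ X → u ⊏ ⟦ s ⟧ → ¬ ConstOn X F f u
      not-const u u↗ _ u⊏s const with separating s u Fs u↗ u⊏s
      ... | t' , Ft' , u⊏t' , fs≢ft' = fs≢ft' (ConstOn⇒≡ const Fs Ft' u⊏s u⊏t')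

    minimal⇒member : Minimal X F f s → F s
    minimal⇒member (s↗ , s⊆X , const , minimal) with M-inhabited infinite s s⊆X
    ... | Y , Y⊆X , Y-infinite , s⊏Y with cond-iii Y Y⊆X Y-infinite
    ...   | t , Ft , t⊏Y with ⊏-comparable s⊏Y t⊏Y
    ...     | inj₁ (inj₁ t≐s) = subst F (Increasing-≐⇒≡ (finite-sets t Ft) s↗ t≐s) Ft
    ...     | inj₁ (inj₂ (_ , t-seg)) =
      ⊥-elim (minimal t (finite-sets t Ft) (member⊆X Ft) (segment⇒⊏ t-seg) (member-ConstOn Ft))
    ...     | inj₂ s⊏t with separating t s Ft s↗ s⊏t
    ...       | t' , Ft' , s⊏t' , ft≢ft' = ⊥-elim (ft≢ft' (ConstOn⇒≡ const Ft Ft' s⊏t s⊏t'))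

lemma3p32 : (E : Set) (X : Subset) (F : List ℕ → Set) (f : List ℕ → E) →
    Infinite X → Front X F →
    Spare X F f ⇔
      (∀ t s → F t → Increasing s → s ⊏ ⟦ t ⟧ →
        ∃ λ t' → F t' × s ⊏ ⟦ t' ⟧ × f t ≢ f t')
lemma3p32 E X F f infinite front =
  mk⇔ (spare⇒separating f infinite front) (separating⇒spare f infinite front)
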